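{- The Factor strategy is productive. Concretely: let $\mathcal{T}=((t,u),\mathcal{O},\mathcal{R})$ be a tiling, $\mathcal{A}=\operatorname{Grid}(\mathcal{T})$, and let $P=\{P_1,\ldots,P_m\}$ be a partition of the nonempty cells of $\mathcal{T}$ into non-interacting parts, with children $\mathcal{B}^{(1)},\ldots,\mathcal{B}^{(m)}$ as defined in the context, each of which contains a gridded permutation of size at least $1$. Let $S=\{i\in\{1,\ldots,m\}: |\mathcal{B}^{(j)}_0|=0 \text{ for some } j\ne i\}$, and use the reliance profile $r(n)=(r^{(1)}(n),\ldots,r^{(m)}(n))$ with $r^{(i)}(n)=n-1$ if $i\in S$ and $r^{(i)}(n)=n$ if $i\notin S$. Then: (1) $r^{(i)}(n)\le n$ for all $i,n$; and (2) for every $i$ such that $r^{(i)}(N)\ge N$ for some $N$ (i.e., $i\notin S$), we have $|\mathcal{A}_n|\ge|\mathcal{B}^{(i)}_n|$ for all $n\in\mathbb{N}$ and $|\mathcal{A}_\ell|>|\mathcal{B}^{(i)}_\ell|$ for some $\ell\in\mathbb{N}$.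
   Context: A gridded permutation of size $n$ is a pair $(\pi,(c_1,\ldots,c_n))$ with $\pi$ a permutation of $\{1,\ldots,n\}$ and cells $c_i=(x_i,y_i)\in\mathbb{N}^2$ such that $x_i\le x_j$ whenever $i<j$ and $y_i\le y_j$ whenever $\pi(i)<\pi(j)$; $\mathcal{G}^{(t,u)}$ is the set of those with all cells in $\{0,\ldots,t-1\}\times\{0,\ldots,u-1\}$. Containment: $g$ contains $h$ if some subsequence of $g$'s permutation is order-isomorphic to $h$'s permutation and the corresponding cells of $g$ equal the cells of $h$. A tiling $((t,u),\mathcal{O},\mathcal{R})$ has obstructions $\mathcal{O}$ and requirement lists $\mathcal{R}$; $\operatorname{Grid}$ consists of elements of $\mathcal{G}^{(t,u)}$ avoiding all obstructions and containing at least one element of each requirement list. A cell $c$ is empty if $(1,(c))\in\mathcal{O}$, nonempty otherwise. For a set $\mathcal{X}$ of gridded permutations, $\mathcal{X}_n$ is its set of elements of size $n$. The parts of $P$ are non-interacting: no cell of one part shares a row or a column with a cell of a different part, no obstruction has entries in cells of two different parts, and for each requirement list there is a single part containing all cells used by all its members. The child $\mathcal{B}^{(i)}$ is the set of gridded permutations all of whose entries lie in cells of $P_i$, that avoid every obstruction of $\mathcal{T}$ and that contain at least one element of each requirement list of $\mathcal{T}$ whose cells lie in $P_i$ (the tiling obtained by restricting $\mathcal{T}$ to the rows and columns of $P_i$). The counting functions of the strategy are $c_{(n)}(b^{(1)},\ldots,b^{(m)})=\sum b^{(1)}_{i_1}\cdots b^{(m)}_{i_m}$ over $(i_1,\ldots,i_m)\in\{0,\ldots,n\}^m$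 with $i_1+\cdots+i_m=n$ and $i_\ell\ne n$ whenever $\ell\in S$. Condition (1) and (2) of the claim are exactly the two conditions defining a productive strategy (the parent at size $N$ relies on child $i$ at size $j$ iff $0\le j\le r^{(i)}(N)$). -}

module Defs where

open import Data.Bool using (Bool; true; false; _∧_; _∨_; not; if_then_else_)
open import Data.Nat using (ℕ; zero; suc; _<ᵇ_; _≡ᵇ_; _≤ᵇ_; _<_; _≤_)
open import Data.Integer using (ℤ; +_; _-_)
open import Data.Product using (_×_; _,_; proj₁; proj₂; Σ; ∃; ∃-syntax)
open import Data.List using (List; []; _∷_; _++_; map; concatMap; length; zip;
  filterᵇ; upTo)
open import Data.Bool.ListAction using (all; any)
open import Data.List.Membership.Propositional using (_∈_)
open import Data.Fin using (Fin; _≟_)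
open import Data.List using () renaming (allFin to allFinL)
open import Relation.Nullary using (¬_; does)
open import Relation.Binary.PropositionalEquality using (_≡_; _≢_)

-- A cell is a pair (x , y) ∈ ℕ².  A gridded permutation (π , (c₁,…,cₙ))
-- of size n is encoded as the list  (π(1) , c₁) ∷ … ∷ (π(n) , cₙ),
-- with permutation values 0-based (π(i) ∈ {0,…,n-1}).

Cell : Set
Cell = ℕ × ℕ

Entry : Set
Entry = ℕ × Cell

GP : Set
GP = List Entry

size : GP → ℕ
size = length

val : Entry → ℕ
val = proj₁

cell : Entry → Cell
cell = proj₂

_==ᶜ_ : Cell → Cell → Bool
(a , b) ==ᶜ (c , d) = (a ≡ᵇ c) ∧ (b ≡ᵇ d)

pairs : {A : Set} → List A → List (A × A)
pairs xs = concatMap (λ a → map (λ b → (a , b)) xs) xs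

distinct : List ℕ → Bool
distinct [] = true
distinct (x ∷ xs) = not (any (λ y → x ≡ᵇ y) xs) ∧ distinct xs

xSorted : GP → Bool
xSorted [] = true
xSorted (e ∷ es) = all (λ e' → proj₁ (cell e) ≤ᵇ proj₁ (cell e')) es ∧ xSorted es

yCompatible : GP → Bool
yCompatible g = all (λ p → not (val (proj₁ p) <ᵇ val (proj₂ p))
                        ∨ (proj₂ (cell (proj₁ p)) ≤ᵇ proj₂ (cell (proj₂ p))))
                    (pairs g)

isGP : ℕ → ℕ → GP → Bool
isGP t u g =
  all (λ e → val e <ᵇ length g) g ∧ distinct (map val g) ∧
  all (λ e → (proj₁ (cell e) <ᵇ t) ∧ (proj₂ (cell e) <ᵇ u)) g ∧
  xSorted g ∧ yCompatible g

sublists : {A : Set} → List A → List (List A)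
sublists [] = [] ∷ []
sublists (x ∷ xs) = map (x ∷_) (sublists xs) ++ sublists xs

orderIso : List ℕ → List ℕ → Bool
orderIso xs ys = (length xs ≡ᵇ length ys) ∧
  all (λ p → not (xor (proj₁ (proj₁ p) <ᵇ proj₁ (proj₂ p))
                      (proj₂ (proj₁ p) <ᵇ proj₂ (proj₂ p))))
      (pairs (zip xs ys))
  where
  xor : Bool → Bool → Bool
  xor a b = (a ∧ not b) ∨ (not a ∧ b)

cellsEq : List Cell → List Cell → Bool
cellsEq [] [] = true
cellsEq (c ∷ cs) (d ∷ ds) = (c ==ᶜ d) ∧ cellsEq cs ds
cellsEq _ _ = false

contains : GP → GP → Bool
contains g h = any (λ s → orderIso (map val s) (map val h) ∧
                          cellsEq (map cell s) (map cell h))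
                   (sublists g)

record Tiling : Set where
  field
    t    : ℕ
    u    : ℕ
    obs  : List GP
    reqs : List (List GP)
open Tiling public

WellFormed : Tiling → Set
WellFormed T = (∀ o → o ∈ obs T → isGP (t T) (u T) o ≡ true)
             × (∀ R → R ∈ reqs T → ∀ h → h ∈ R → isGP (t T) (u T) h ≡ true)

avoidsObs : Tiling → GP → Bool
avoidsObs T g = all (λ o → not (contains g o)) (obs T)

inGrid : Tiling → GP → Bool
inGrid T g = isGP (t T) (u T) g ∧ avoidsObs T g ∧
             all (λ R → any (contains g) R) (reqs T)

words : {A : Set} → List A → ℕ → List (List A)
words xs zero = [] ∷ []
words xs (suc n) = concatMap (λ a → map (a ∷_) (words xs n)) xs

allCells : ℕ → ℕ → List Cell
allCells t u = concatMap (λ x → map (x ,_) (upTo u)) (upTo t)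

-- enumeration (without repetition) of 𝒢^(t,u)_n
allGP : ℕ → ℕ → ℕ → List GP
allGP t u n = filterᵇ (isGP t u)
  (concatMap (λ vs → map (zip vs) (words (allCells t u) n))
             (filterᵇ distinct (words (upTo n) n)))

count : ℕ → ℕ → (GP → Bool) → ℕ → ℕ
count t u p n = length (filterᵇ p (allGP t u n))

-- the cell c is empty in T : (1,(c)) ∈ 𝒪
EmptyCell : Tiling → Cell → Set
EmptyCell T c = ((0 , c) ∷ []) ∈ obs T

InGridCell : Tiling → Cell → Set
InGridCell T (x , y) = (x < t T) × (y < u T)

NonemptyCell : Tiling → Cell → Set
NonemptyCell T c = InGridCell T c × ¬ EmptyCell T c

IsPartition : (T : Tiling) (m : ℕ) → (Fin m → List Cell) → Set
IsPartition T m P =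
  (∀ i c → c ∈ P i → NonemptyCell T c) ×
  (∀ c → NonemptyCell T c → ∃[ i ] (c ∈ P i)) ×
  (∀ i j c → c ∈ P i → c ∈ P j → i ≡ j)

NonInteracting : (T : Tiling) (m : ℕ) → (Fin m → List Cell) → Set
NonInteracting T m P =
  (∀ i j c d → i ≢ j → c ∈ P i → d ∈ P j →
     (proj₁ c ≢ proj₁ d) × (proj₂ c ≢ proj₂ d)) ×
  (∀ o → o ∈ obs T → ∀ i j e e' → i ≢ j → e ∈ o → e' ∈ o →
     cell e ∈ P i → ¬ (cell e' ∈ P j)) ×
  (∀ R → R ∈ reqs T → ∃[ i ] (∀ h → h ∈ R → ∀ e → e ∈ h → cell e ∈ P i))

inPart : List Cell → Cell → Bool
inPart cs c = any (c ==ᶜ_) cs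

inChild : (T : Tiling) {m : ℕ} → (Fin m → List Cell) → Fin m → GP → Bool
inChild T P i g =
  isGP (t T) (u T) g ∧
  all (λ e → inPart (P i) (cell e)) g ∧
  avoidsObs T g ∧
  all (λ R → not (all (λ h → all (λ e → inPart (P i) (cell e)) h) R)
             ∨ any (contains g) R)
      (reqs T)

countA : Tiling → ℕ → ℕ
countA T = count (t T) (u T) (inGrid T)

countB : (T : Tiling) {m : ℕ} → (Fin m → List Cell) → Fin m → ℕ → ℕ
countB T P i = count (t T) (u T) (inChild T P i)

inS : (T : Tiling) {m : ℕ} → (Fin m → List Cell) → Fin m → Bool
inS T {m} P i = any (λ j → not (does (j ≟ i)) ∧ (countB T P j 0 ≡ᵇ 0)) (allFinL m)

reliance : (T : Tiling) {m : ℕ} → (Fin m → List Cell) → Fin m → ℕ → ℤ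
reliance T P i n = if inS T P i then (+ n) - (+ 1) else + n

{-# OPTIONS --safe #-}
module Submission where

-- For part (2), r⁽ⁱ⁾(N) ≥ N forces i ∉ S, so every other child B⁽ᵏ⁾
-- contains the empty gridded permutation; a requirement list lying in P_k (k ≠ i) is then met by
-- an element contained in the empty permutation, hence by everything. So B⁽ⁱ⁾ ⊆ Grid(T) and
-- |B⁽ⁱ⁾ₙ| ≤ |𝒜ₙ|. For strictness take g ∈ B⁽ⁱ⁾ and a cell c of another part P_j (it exists since
-- B⁽ʲ⁾ has a nonempty element) and insert a point into c, relabelling the values so that the
-- result is still a gridded permutation. An obstruction contained in the result either avoids
-- the new point (so g contains it), or is the one-point obstruction of c (but c is nonempty),
-- or has entries in c and in a cell of P_i (excluded by non-interaction).
-- The result therefore lies in 𝒜 but, having an entry outside P_i, not in B⁽ⁱ⁾.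

open import Defs
open import Data.Bool using (Bool; true; false; T; T?; _∧_; _∨_; not; if_then_else_)
open import Data.Bool.Properties using (T-≡; T-∧; T-∨)
open import Data.Bool.ListAction using (all; any; and; or)
open import Data.Empty using (⊥-elim)
open import Data.Fin using (Fin; _≟_) renaming (zero to fzero; suc to fsuc)
open import Data.Integer using (+_) renaming (_≤_ to _≤ℤ_)
import Data.Integer.Properties as ℤ
open import Data.List using (List; []; _∷_; [_]; length; map; _++_; zip; concatMap; filterᵇ; upTo)
open import Data.List.Properties
  using (map-∘; map-++; map-id; map-cong; length-map; zip-map; concatMap-map; concatMap-cong; map-concatMap)
open import Data.List.Membership.Propositional using (_∈_; find; lose)
open import Data.List.Membership.Propositional.Properties
  using ( ∈-map⁺; ∈-map⁻; ∈-++⁺ˡ; ∈-++⁺ʳ; ∈-++⁻; ∈-concatMap⁺; ∈-concatMap⁻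
        ; ∈-filter⁺; ∈-filter⁻; ∈-upTo⁺; ∈-allFin)
open import Data.List.Relation.Binary.Equality.Propositional using (≋⇒≡)
open import Data.List.Relation.Binary.Sublist.Propositional
  using (_⊆_; []; _∷_; _∷ʳ_; ⊆-trans; ⊆-refl; minimum; lookup)
open import Data.List.Relation.Binary.Sublist.Propositional.Properties using (filter⁺; length-mono-≤; to-≋)
open import Data.List.Relation.Unary.All as All using (All; []; _∷_)
open import Data.List.Relation.Unary.All.Properties as All using (all⁺; all⁻)
open import Data.List.Relation.Unary.AllPairs as AllPairs using (AllPairs; []; _∷_)
import Data.List.Relation.Unary.AllPairs.Properties as AllPairs
open import Data.List.Relation.Unary.Any using (here; there)
open import Data.List.Relation.Unary.Any.Properties using (any⁺; any⁻)
open import Data.List.Relation.Unary.Unique.Propositional using (Unique)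
open import Data.Nat using (ℕ; suc; s≤s; z≤n; _≤_; _<_; _<ᵇ_; _≤ᵇ_; _≡ᵇ_; _⊔_)
open import Data.Nat.Properties using (<ᵇ⇒<; <⇒<ᵇ; ≤ᵇ⇒≤; ≤⇒≤ᵇ; ≡ᵇ⇒≡; ≡⇒≡ᵇ)
import Data.Nat.Properties as ℕ
open import Data.Product using (_×_; ∃; ∃-syntax; _,_; proj₁; proj₂; map₁)
import Data.Product as Product
open import Data.Sum using (_⊎_; inj₁; inj₂; [_,_]′)
open import Function using (id; _∘_)
open import Function.Bundles using (_⇔_; mk⇔; Equivalence)
open import Relation.Binary.Definitions using (tri<; tri≈; tri>; Symmetric)
open import Relation.Binary.PropositionalEquality
  using (_≡_; _≢_; refl; sym; trans; cong; cong₂; subst; module ≡-Reasoning)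
open import Relation.Nullary using (¬_; yes; no; does)

open Equivalence using (to; from)

T-not : ∀ {b} → T (not b) ⇔ (¬ T b)
T-not {true}  = mk⇔ (λ ()) (λ ¬tt → ¬tt _)
T-not {false} = mk⇔ (λ _ ()) (λ _ → _)

<ᵇ⇔< : ∀ {a b} → T (a <ᵇ b) ⇔ a < b
<ᵇ⇔< {a} {b} = mk⇔ (<ᵇ⇒< a b) <⇒<ᵇ

≤ᵇ⇔≤ : ∀ {a b} → T (a ≤ᵇ b) ⇔ a ≤ b
≤ᵇ⇔≤ {a} {b} = mk⇔ (≤ᵇ⇒≤ a b) ≤⇒≤ᵇ

<ᵇ-cong : ∀ {a b c d} → (a < b ⇔ c < d) → (a <ᵇ b) ≡ (c <ᵇ d)
<ᵇ-cong {a} {b} {c} {d} a<b⇔c<d with a <ᵇ b in ab | c <ᵇ d in cd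
... | true  | true  = refl
... | false | false = refl
... | true  | false = ⊥-elim (subst T cd (<⇒<ᵇ (to a<b⇔c<d (<ᵇ⇒< a b (subst T (sym ab) _)))))
... | false | true  = ⊥-elim (subst T ab (<⇒<ᵇ (from a<b⇔c<d (<ᵇ⇒< c d (subst T (sym cd) _)))))

module _ {A : Set} (p : A → Bool) where

  allᵇ-lookup : ∀ {xs} → T (all p xs) → ∀ {x} → x ∈ xs → T (p x)
  allᵇ-lookup {xs} h = All.lookup (all⁺ p xs h)

  allᵇ-tabulate : ∀ {xs} → (∀ {x} → x ∈ xs → T (p x)) → T (all p xs)
  allᵇ-tabulate f = all⁻ p (All.tabulate f)

  anyᵇ-find : ∀ {xs} → T (any p xs) → ∃ λ x → x ∈ xs × T (p x)
  anyᵇ-find {xs} h = find (any⁻ p xs h)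

  anyᵇ-lose : ∀ {xs x} → x ∈ xs → T (p x) → T (any p xs)
  anyᵇ-lose x∈xs px = any⁺ p (lose x∈xs px)

allᵇ⇔All : {A : Set} {p : A → Bool} {P : A → Set} → (∀ x → T (p x) ⇔ P x) →
           ∀ {xs} → T (all p xs) ⇔ All P xs
allᵇ⇔All {p = p} p⇔P = mk⇔
  (λ h → All.tabulate (λ x∈ → to (p⇔P _) (allᵇ-lookup p h x∈)))
  (λ ps → allᵇ-tabulate p (λ x∈ → from (p⇔P _) (All.lookup ps x∈)))

module _ {A : Set} {p q : A → Bool} (p⇒q : ∀ {x} → T (p x) → T (q x)) where

  any-mono : ∀ xs → T (any p xs) → T (any q xs)
  any-mono xs h = let x , x∈ , px = anyᵇ-find p {xs} h in anyᵇ-lose q x∈ (p⇒q px)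

  all-any-mono : ∀ Rs → T (all (any p) Rs) → T (all (any q) Rs)
  all-any-mono Rs h =
    allᵇ-tabulate (any q) {Rs} λ {R} R∈ → any-mono R (allᵇ-lookup (any p) {Rs} h R∈)

==ᶜ⇒≡ : ∀ {c d} → T (c ==ᶜ d) → c ≡ d
==ᶜ⇒≡ {a , b} {c , d} h = let a≡c , b≡d = to T-∧ h in cong₂ _,_ (≡ᵇ⇒≡ a c a≡c) (≡ᵇ⇒≡ b d b≡d)

==ᶜ-refl : ∀ c → T (c ==ᶜ c)
==ᶜ-refl (a , b) = from T-∧ (≡⇒≡ᵇ a a refl , ≡⇒≡ᵇ b b refl)

inPart⇔∈ : ∀ {cs c} → T (inPart cs c) ⇔ c ∈ cs
inPart⇔∈ {cs} {c} = mk⇔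
  (λ h → let d , d∈cs , c==d = anyᵇ-find (c ==ᶜ_) h in subst (_∈ cs) (sym (==ᶜ⇒≡ c==d)) d∈cs)
  (λ c∈cs → anyᵇ-lose (c ==ᶜ_) c∈cs (==ᶜ-refl c))

cellsEq⇒≡ : ∀ cs ds → T (cellsEq cs ds) → cs ≡ ds
cellsEq⇒≡ []       []       _ = refl
cellsEq⇒≡ (c ∷ cs) (d ∷ ds) h = let c==d , rest = to T-∧ h in cong₂ _∷_ (==ᶜ⇒≡ c==d) (cellsEq⇒≡ cs ds rest)

module _ {A : Set} where

  ∈-sublists⁺ : ∀ {s g : List A} → s ⊆ g → s ∈ sublists g
  ∈-sublists⁺ []                 = here refl
  ∈-sublists⁺ {g = y ∷ g} (y ∷ʳ s⊆g) = ∈-++⁺ʳ (map (y ∷_) (sublists g)) (∈-sublists⁺ s⊆g)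
  ∈-sublists⁺ (refl ∷ s⊆g)       = ∈-++⁺ˡ (∈-map⁺ _ (∈-sublists⁺ s⊆g))

  ∈-sublists⁻ : ∀ {s} (g : List A) → s ∈ sublists g → s ⊆ g
  ∈-sublists⁻ []      (here refl) = []
  ∈-sublists⁻ (y ∷ g) s∈ with ∈-++⁻ (map (y ∷_) (sublists g)) s∈
  ... | inj₂ s∈′ = y ∷ʳ ∈-sublists⁻ g s∈′
  ... | inj₁ s∈′ with ∈-map⁻ (y ∷_) s∈′
  ...   | s′ , s′∈ , refl = refl ∷ ∈-sublists⁻ g s′∈

sublists-map : {A B : Set} (f : A → B) (g : List A) → sublists (map f g) ≡ map (map f) (sublists g)
sublists-map f []      = refl
sublists-map f (x ∷ g) = begin
  map (f x ∷_) (sublists (map f g)) ++ sublists (map f g)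
    ≡⟨ cong (λ ss → map (f x ∷_) ss ++ ss) (sublists-map f g) ⟩
  map (f x ∷_) (map (map f) ss) ++ map (map f) ss
    ≡⟨ cong (_++ map (map f) ss) (trans (sym (map-∘ ss)) (map-∘ ss)) ⟩
  map (map f) (map (x ∷_) ss) ++ map (map f) ss
    ≡⟨ sym (map-++ (map f) (map (x ∷_) ss) ss) ⟩
  map (map f) (map (x ∷_) ss ++ ss) ∎
  where
  open ≡-Reasoning
  ss = sublists g

matches : GP → GP → Bool
matches h s = orderIso (map val s) (map val h) ∧ cellsEq (map cell s) (map cell h)

contains⁻ : ∀ {g h} → T (contains g h) → ∃ λ s → s ⊆ g × T (matches h s)
contains⁻ {g} {h} c = let s , s∈ , m = anyᵇ-find (matches h) c in s , ∈-sublists⁻ g s∈ , m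

contains⁺ : ∀ {s g h} → s ⊆ g → T (matches h s) → T (contains g h)
contains⁺ {h = h} s⊆g m = anyᵇ-lose (matches h) (∈-sublists⁺ s⊆g) m

contains-mono : ∀ {g g′ h} → g ⊆ g′ → T (contains g h) → T (contains g′ h)
contains-mono g⊆g′ c = let s , s⊆g , m = contains⁻ c in contains⁺ (⊆-trans s⊆g g⊆g′) m

-- Order-preserving relabelling

module _ {A : Set} where

  ∈-pairs⁺ : ∀ {xs : List A} {a b} → a ∈ xs → b ∈ xs → (a , b) ∈ pairs xs
  ∈-pairs⁺ {a = a} a∈xs b∈xs = ∈-concatMap⁺ _ (lose a∈xs (∈-map⁺ (a ,_) b∈xs))

  ∈-pairs⁻ : ∀ {xs : List A} {a b} → (a , b) ∈ pairs xs → a ∈ xs × b ∈ xs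
  ∈-pairs⁻ ab∈ with find (∈-concatMap⁻ _ ab∈)
  ... | a , a∈xs , ab∈′ with ∈-map⁻ (a ,_) ab∈′
  ...   | b , b∈xs , refl = a∈xs , b∈xs

pairs-map : {A B : Set} (k : A → B) (xs : List A) →
            pairs (map k xs) ≡ map (Product.map k k) (pairs xs)
pairs-map k xs = begin
  concatMap (λ a → map (a ,_) (map k xs)) (map k xs)
    ≡⟨ concatMap-map _ k xs ⟩
  concatMap (λ a → map (k a ,_) (map k xs)) xs
    ≡⟨ concatMap-cong (λ a → trans (sym (map-∘ xs)) (map-∘ xs)) xs ⟩
  concatMap (λ a → map (Product.map k k) (map (a ,_) xs)) xs
    ≡⟨ sym (map-concatMap (Product.map k k) _ xs) ⟩
  map (Product.map k k) (pairs xs) ∎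
  where open ≡-Reasoning

-- The pair test of Defs' orderIso, restated by hand since it is a where-bound function there.
sameOrder : (ℕ × ℕ) × (ℕ × ℕ) → Bool
sameOrder ((a , c) , (b , d)) = not (((a <ᵇ b) ∧ not (c <ᵇ d)) ∨ (not (a <ᵇ b) ∧ (c <ᵇ d)))

orderIso-map : (f : ℕ → ℕ) → (∀ a b → (f a <ᵇ f b) ≡ (a <ᵇ b)) →
               ∀ xs ys → orderIso (map f xs) ys ≡ orderIso xs ys
orderIso-map f f-<ᵇ xs ys = cong₂ _∧_ (cong (_≡ᵇ length ys) (length-map f xs)) (begin
  all sameOrder (pairs (zip (map f xs) ys))
    ≡⟨ cong (all sameOrder ∘ pairs)
            (trans (cong (zip (map f xs)) (sym (map-id ys))) (zip-map f id xs ys)) ⟩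
  all sameOrder (pairs (map (map₁ f) (zip xs ys)))
    ≡⟨ cong (all sameOrder) (pairs-map (map₁ f) (zip xs ys)) ⟩
  all sameOrder (map (Product.map (map₁ f) (map₁ f)) (pairs (zip xs ys)))
    ≡⟨ cong and (sym (map-∘ (pairs (zip xs ys)))) ⟩
  all (sameOrder ∘ Product.map (map₁ f) (map₁ f)) (pairs (zip xs ys))
    ≡⟨ cong and (map-cong invariant (pairs (zip xs ys))) ⟩
  all sameOrder (pairs (zip xs ys)) ∎)
  where
  open ≡-Reasoning
  invariant : ∀ pq → sameOrder (Product.map (map₁ f) (map₁ f) pq) ≡ sameOrder pq
  invariant ((a , c) , (b , d)) rewrite f-<ᵇ a b = refl

module _ (f : ℕ → ℕ) (f-<ᵇ : ∀ a b → (f a <ᵇ f b) ≡ (a <ᵇ b)) where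

  matches-relabel : ∀ h s → matches h (map (map₁ f) s) ≡ matches h s
  matches-relabel h s = cong₂ _∧_
    (trans (cong (λ vs → orderIso vs (map val h)) (trans (sym (map-∘ s)) (map-∘ s)))
           (orderIso-map f f-<ᵇ (map val s) (map val h)))
    (cong (λ cs → cellsEq cs (map cell h)) (sym (map-∘ s)))

  contains-relabel : ∀ g h → contains (map (map₁ f) g) h ≡ contains g h
  contains-relabel g h = begin
    any (matches h) (sublists (map (map₁ f) g))
      ≡⟨ cong (any (matches h)) (sublists-map (map₁ f) g) ⟩
    any (matches h) (map (map (map₁ f)) (sublists g))
      ≡⟨ cong or (sym (map-∘ (sublists g))) ⟩
    any (matches h ∘ map (map₁ f)) (sublists g)
      ≡⟨ cong or (map-cong (matches-relabel h) (sublists g)) ⟩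
    any (matches h) (sublists g) ∎
    where open ≡-Reasoning

module StrictlyMonotone (f : ℕ → ℕ) (f-mono : ∀ {a b} → a < b → f a < f b) where

  cancel-< : ∀ {a b} → f a < f b → a < b
  cancel-< {a} {b} fa<fb with ℕ.<-cmp a b
  ... | tri< a<b _ _ = a<b
  ... | tri≈ _ refl _ = ⊥-elim (ℕ.<-irrefl refl fa<fb)
  ... | tri> _ _ b<a = ⊥-elim (ℕ.<-asym fa<fb (f-mono b<a))

  injective : ∀ {a b} → f a ≡ f b → a ≡ b
  injective {a} {b} fa≡fb with ℕ.<-cmp a b
  ... | tri< a<b _ _ = ⊥-elim (ℕ.<⇒≢ (f-mono a<b) fa≡fb)
  ... | tri≈ _ a≡b _ = a≡b
  ... | tri> _ _ b<a = ⊥-elim (ℕ.<⇒≢ (f-mono b<a) (sym fa≡fb))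

  <ᵇ-invariant : ∀ a b → (f a <ᵇ f b) ≡ (a <ᵇ b)
  <ᵇ-invariant a b = <ᵇ-cong (mk⇔ cancel-< f-mono)

bump : ℕ → ℕ → ℕ
bump w v = if v <ᵇ w then v else suc v

bump-cases : ∀ w v → (v < w × bump w v ≡ v) ⊎ (w ≤ v × bump w v ≡ suc v)
bump-cases w v with v <ᵇ w in v<ᵇw
... | true  = inj₁ (<ᵇ⇒< v w (subst T (sym v<ᵇw) _) , refl)
... | false = inj₂ (ℕ.≮⇒≥ (λ v<w → subst T v<ᵇw (<⇒<ᵇ v<w)) , refl)

bump-mono-< : ∀ w {a b} → a < b → bump w a < bump w b
bump-mono-< w {a} {b} a<b with bump-cases w a | bump-cases w b
... | inj₁ (_ , ea)     | inj₁ (_ , eb)     rewrite ea | eb = a<b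
... | inj₁ (_ , ea)     | inj₂ (_ , eb)     rewrite ea | eb = ℕ.m≤n⇒m≤1+n a<b
... | inj₂ (w≤a , _)    | inj₁ (b<w , _)    = ⊥-elim (ℕ.<-asym a<b (ℕ.<-≤-trans b<w w≤a))
... | inj₂ (_ , ea)     | inj₂ (_ , eb)     rewrite ea | eb = s≤s a<b

module Bump (w : ℕ) = StrictlyMonotone (bump w) (bump-mono-< w)

bump≢ : ∀ w v → bump w v ≢ w
bump≢ w v with bump-cases w v
... | inj₁ (v<w , e) = λ b≡w → ℕ.<⇒≢ v<w (trans (sym e) b≡w)
... | inj₂ (w≤v , e) = λ b≡w → ℕ.<⇒≢ (s≤s w≤v) (sym (trans (sym e) b≡w))

bump≤suc : ∀ w v → bump w v ≤ suc v
bump≤suc w v with bump-cases w v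
... | inj₁ (_ , e) rewrite e = ℕ.n≤1+n v
... | inj₂ (_ , e) rewrite e = ℕ.≤-refl

bump<⇔< : ∀ w v → bump w v < w ⇔ v < w
bump<⇔< w v with bump-cases w v
... | inj₁ (v<w , e) rewrite e = mk⇔ id id
... | inj₂ (w≤v , e) rewrite e = mk⇔ (λ sv<w → ⊥-elim (ℕ.<-asym sv<w (s≤s w≤v)))
                                     (λ v<w → ⊥-elim (ℕ.<⇒≱ v<w w≤v))

col row : Entry → ℕ
col e = proj₁ (cell e)
row e = proj₂ (cell e)

RowsCompatible : GP → Set
RowsCompatible g = ∀ {a b} → a ∈ g → b ∈ g → val a < val b → row a ≤ row b

record IsGridded (t u : ℕ) (g : GP) : Set where
  field
    vals-bounded    : All (λ e → val e < length g) g
    vals-distinct   : AllPairs (λ a b → val a ≢ val b) g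
    cells-bounded   : All (λ e → col e < t × row e < u) g
    cols-sorted     : AllPairs (λ a b → col a ≤ col b) g
    rows-compatible : RowsCompatible g

distinct⇔Unique : ∀ xs → T (distinct xs) ⇔ Unique xs
distinct⇔Unique []       = mk⇔ (λ _ → []) (λ _ → _)
distinct⇔Unique (x ∷ xs) = mk⇔
  (λ h → let fresh , rest = to T-∧ h in freshAll fresh ∷ to (distinct⇔Unique xs) rest)
  (λ { (x∉xs ∷ u) → from T-∧ (allFresh x∉xs , from (distinct⇔Unique xs) u) })
  where
  freshAll : T (not (any (x ≡ᵇ_) xs)) → All (x ≢_) xs
  freshAll h = All.tabulate (λ y∈ x≡y → to T-not h (anyᵇ-lose (x ≡ᵇ_) y∈ (≡⇒≡ᵇ x _ x≡y)))
  allFresh : All (x ≢_) xs → T (not (any (x ≡ᵇ_) xs))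
  allFresh x∉xs = from T-not (λ h → let y , y∈ , x≡ᵇy = anyᵇ-find (x ≡ᵇ_) h in
                                     All.lookup x∉xs y∈ (≡ᵇ⇒≡ x y x≡ᵇy))

xSorted⇔ : ∀ g → T (xSorted g) ⇔ AllPairs (λ a b → col a ≤ col b) g
xSorted⇔ []      = mk⇔ (λ _ → []) (λ _ → _)
xSorted⇔ (e ∷ g) = mk⇔
  (λ h → let first , rest = to T-∧ h in to (allᵇ⇔All λ _ → ≤ᵇ⇔≤) first ∷ to (xSorted⇔ g) rest)
  (λ { (first ∷ rest) → from T-∧ (from (allᵇ⇔All λ _ → ≤ᵇ⇔≤) first , from (xSorted⇔ g) rest) })

yCompatible⇔ : ∀ g → T (yCompatible g) ⇔ RowsCompatible g
yCompatible⇔ g = mk⇔ sound complete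
  where
  compatible : Entry × Entry → Bool
  compatible (a , b) = not (val a <ᵇ val b) ∨ (row a ≤ᵇ row b)
  compatible-sound : ∀ a b → T (not (val a <ᵇ val b)) ⊎ T (row a ≤ᵇ row b) → val a < val b → row a ≤ row b
  compatible-sound a b (inj₁ ¬lt) va<vb = ⊥-elim (to T-not ¬lt (<⇒<ᵇ va<vb))
  compatible-sound a b (inj₂ le)  _     = ≤ᵇ⇒≤ (row a) (row b) le
  compatible-complete : RowsCompatible g → ∀ {a b} → a ∈ g × b ∈ g → T (not (val a <ᵇ val b) ∨ (row a ≤ᵇ row b))
  compatible-complete compat {a} {b} (a∈ , b∈) with val a <ᵇ val b in lt
  ... | false = _
  ... | true  = ≤⇒≤ᵇ (compat a∈ b∈ (<ᵇ⇒< (val a) (val b) (subst T (sym lt) _)))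
  sound : T (yCompatible g) → RowsCompatible g
  sound h {a} {b} a∈ b∈ = compatible-sound a b (to T-∨ (allᵇ-lookup compatible h (∈-pairs⁺ a∈ b∈)))
  complete : RowsCompatible g → T (yCompatible g)
  complete compat = allᵇ-tabulate compatible (λ { {a , b} ab∈ → compatible-complete compat (∈-pairs⁻ ab∈) })

isGP⇔IsGridded : ∀ t u g → T (isGP t u g) ⇔ IsGridded t u g
isGP⇔IsGridded t u g = mk⇔ toGridded fromGridded
  where
  cellOK : ∀ e → T ((col e <ᵇ t) ∧ (row e <ᵇ u)) ⇔ (col e < t × row e < u)
  cellOK e = mk⇔ (λ h → let a , b = to T-∧ h in to <ᵇ⇔< a , to <ᵇ⇔< b)
               (λ { (a , b) → from T-∧ (from <ᵇ⇔< a , from <ᵇ⇔< b) })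
  toGridded : T (isGP t u g) → IsGridded t u g
  toGridded h =
    let h₁ , h′ = to T-∧ h ; h₂ , h″ = to T-∧ h′ ; h₃ , h‴ = to T-∧ h″ ; h₄ , h₅ = to T-∧ h‴
    in record
      { vals-bounded    = to (allᵇ⇔All λ _ → <ᵇ⇔<) h₁
      ; vals-distinct   = AllPairs.map⁻ (to (distinct⇔Unique (map val g)) h₂)
      ; cells-bounded   = to (allᵇ⇔All cellOK) h₃
      ; cols-sorted     = to (xSorted⇔ g) h₄
      ; rows-compatible = to (yCompatible⇔ g) h₅
      }
  fromGridded : IsGridded t u g → T (isGP t u g)
  fromGridded G = from T-∧ (from (allᵇ⇔All λ _ → <ᵇ⇔<) vals-bounded , from T-∧
    (from (distinct⇔Unique (map val g)) (AllPairs.map⁺ vals-distinct) , from T-∧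
    (from (allᵇ⇔All cellOK) cells-bounded , from T-∧
    (from (xSorted⇔ g) cols-sorted , from (yCompatible⇔ g) rows-compatible))))
    where open IsGridded G

AllPairs-≢-injective : ∀ {g} → AllPairs (λ a b → val a ≢ val b) g →
                       ∀ {a b} → a ∈ g → b ∈ g → val a ≡ val b → a ≡ b
AllPairs-≢-injective (_ ∷ _)     (here refl) (here refl) _  = refl
AllPairs-≢-injective (a≢ ∷ _)    (here refl) (there b∈) va≡vb = ⊥-elim (All.lookup a≢ b∈ va≡vb)
AllPairs-≢-injective (b≢ ∷ _)    (there a∈)  (here refl) va≡vb = ⊥-elim (All.lookup b≢ a∈ (sym va≡vb))
AllPairs-≢-injective (_ ∷ rest)  (there a∈)  (there b∈) va≡vb = AllPairs-≢-injective rest a∈ b∈ va≡vb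

-- Inserting a point into a gridded permutation

insertByCol : Entry → GP → GP
insertByCol x []       = [ x ]
insertByCol x (y ∷ ys) = if col x ≤ᵇ col y then x ∷ y ∷ ys else y ∷ insertByCol x ys

module _ (x : Entry) where

  ∈-insertByCol⁻ : ∀ ys {e} → e ∈ insertByCol x ys → e ≡ x ⊎ e ∈ ys
  ∈-insertByCol⁻ []       (here refl) = inj₁ refl
  ∈-insertByCol⁻ (y ∷ ys) e∈ with col x ≤ᵇ col y | e∈
  ... | true  | here refl  = inj₁ refl
  ... | true  | there e∈′  = inj₂ e∈′
  ... | false | here refl  = inj₂ (here refl)
  ... | false | there e∈′ with ∈-insertByCol⁻ ys e∈′
  ...   | inj₁ e≡x  = inj₁ e≡x
  ...   | inj₂ e∈ys = inj₂ (there e∈ys)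

  ∈-insertByCol-self : ∀ ys → x ∈ insertByCol x ys
  ∈-insertByCol-self []       = here refl
  ∈-insertByCol-self (y ∷ ys) with col x ≤ᵇ col y
  ... | true  = here refl
  ... | false = there (∈-insertByCol-self ys)

  length-insertByCol : ∀ ys → length (insertByCol x ys) ≡ suc (length ys)
  length-insertByCol []       = refl
  length-insertByCol (y ∷ ys) with col x ≤ᵇ col y
  ... | true  = refl
  ... | false = cong suc (length-insertByCol ys)

  ⊆-insertByCol : ∀ ys → ys ⊆ insertByCol x ys
  ⊆-insertByCol []       = x ∷ʳ []
  ⊆-insertByCol (y ∷ ys) with col x ≤ᵇ col y
  ... | true  = x ∷ʳ ⊆-refl
  ... | false = refl ∷ ⊆-insertByCol ys

  ⊆-insertByCol⁻ : ∀ ys {s} → s ⊆ insertByCol x ys →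
                   s ⊆ ys ⊎ s ≡ [ x ] ⊎ (x ∈ s × ∃ λ y → y ∈ s × y ∈ ys)
  ⊆-insertByCol⁻ []       (_ ∷ʳ [])  = inj₁ []
  ⊆-insertByCol⁻ []       (refl ∷ []) = inj₂ (inj₁ refl)
  ⊆-insertByCol⁻ (y ∷ ys) s⊆ with col x ≤ᵇ col y | s⊆
  ... | true  | _ ∷ʳ s⊆ys            = inj₁ s⊆ys
  ... | true  | _∷_ {xs = []} refl _ = inj₂ (inj₁ refl)
  ... | true  | _∷_ {xs = z ∷ _} refl s′⊆ =
    inj₂ (inj₂ (here refl , z , there (here refl) , lookup s′⊆ (here refl)))
  ... | false | _ ∷ʳ s⊆′ with ⊆-insertByCol⁻ ys s⊆′
  ...   | inj₁ s⊆ys                 = inj₁ (y ∷ʳ s⊆ys)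
  ...   | inj₂ (inj₁ s≡[x])         = inj₂ (inj₁ s≡[x])
  ...   | inj₂ (inj₂ (x∈s , z , z∈s , z∈ys)) = inj₂ (inj₂ (x∈s , z , z∈s , there z∈ys))
  ⊆-insertByCol⁻ (y ∷ ys) s⊆ | false | refl ∷ s′⊆ with ⊆-insertByCol⁻ ys s′⊆
  ...   | inj₁ s′⊆ys                = inj₁ (refl ∷ s′⊆ys)
  ...   | inj₂ (inj₁ refl)          = inj₂ (inj₂ (there (here refl) , y , here refl , here refl))
  ...   | inj₂ (inj₂ (x∈s′ , _))    = inj₂ (inj₂ (there x∈s′ , y , here refl , here refl))

  All-insertByCol : {P : Entry → Set} → P x → ∀ {ys} → All P ys → All P (insertByCol x ys)
  All-insertByCol px {ys} pys =
    All.tabulate (λ e∈ → [ (λ { refl → px }) , All.lookup pys ]′ (∈-insertByCol⁻ ys e∈))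

  AllPairs-insertByCol : {R : Entry → Entry → Set} → Symmetric R →
                         ∀ {ys} → All (R x) ys → AllPairs R ys → AllPairs R (insertByCol x ys)
  AllPairs-insertByCol R-sym {[]}     []           []          = [] ∷ []
  AllPairs-insertByCol R-sym {y ∷ ys} (rxy ∷ rxys) (ry ∷ rys) with col x ≤ᵇ col y
  ... | true  = (rxy ∷ rxys) ∷ ry ∷ rys
  ... | false = All-insertByCol (R-sym rxy) ry ∷ AllPairs-insertByCol R-sym rxys rys

  insertByCol-sorted : ∀ {ys} → AllPairs (λ a b → col a ≤ col b) ys →
                       AllPairs (λ a b → col a ≤ col b) (insertByCol x ys)
  insertByCol-sorted {[]}     []          = [] ∷ []
  insertByCol-sorted {y ∷ ys} (y≤ ∷ rest) with col x ≤ᵇ col y in x≤ᵇy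
  ... | true  = (x≤y ∷ All.map (ℕ.≤-trans x≤y) y≤) ∷ y≤ ∷ rest
    where x≤y = ≤ᵇ⇒≤ (col x) (col y) (subst T (sym x≤ᵇy) _)
  ... | false = All-insertByCol y≤x y≤ ∷ insertByCol-sorted rest
    where y≤x = ℕ.<⇒≤ (ℕ.≰⇒> (λ x≤y → subst T x≤ᵇy (≤⇒≤ᵇ x≤y)))

rowSlot : Cell → GP → ℕ
rowSlot c []       = 0
rowSlot c (e ∷ es) = if row e <ᵇ proj₂ c then suc (val e) ⊔ rowSlot c es else rowSlot c es

val<rowSlot : ∀ c g {e} → e ∈ g → row e < proj₂ c → val e < rowSlot c g
val<rowSlot c (e ∷ es) (here refl) e-below rewrite to T-≡ (<⇒<ᵇ e-below) =
  ℕ.m≤n⇒m≤n⊔o (rowSlot c es) ℕ.≤-refl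
val<rowSlot c (e ∷ es) (there e′∈) e′-below with row e <ᵇ proj₂ c
... | true  = ℕ.m≤n⇒m≤o⊔n (suc (val e)) (val<rowSlot c es e′∈ e′-below)
... | false = val<rowSlot c es e′∈ e′-below

<rowSlot⇒ : ∀ c g {v} → v < rowSlot c g → ∃ λ e → e ∈ g × row e < proj₂ c × v ≤ val e
<rowSlot⇒ c (e ∷ es) {v} v< with row e <ᵇ proj₂ c in e-below
... | false = let e′ , e′∈ , below , v≤ = <rowSlot⇒ c es v< in e′ , there e′∈ , below , v≤
... | true with ℕ.⊔-sel (suc (val e)) (rowSlot c es)
...   | inj₁ ≡sv = e , here refl , <ᵇ⇒< (row e) (proj₂ c) (subst T (sym e-below) _) ,
                   ℕ.≤-pred (subst (v <_) ≡sv v<)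
...   | inj₂ ≡rest = let e′ , e′∈ , below , v≤ = <rowSlot⇒ c es (subst (v <_) ≡rest v<)
                     in e′ , there e′∈ , below , v≤

rowSlot≤ : ∀ c {n} g → All (λ e → val e < n) g → rowSlot c g ≤ n
rowSlot≤ c []       []            = z≤n
rowSlot≤ c (e ∷ es) (ve<n ∷ rest) with row e <ᵇ proj₂ c
... | true  = ℕ.⊔-lub ve<n (rowSlot≤ c es rest)
... | false = rowSlot≤ c es rest

-- The new point in c takes the value just above every value lying in a lower row;
-- `bump` shifts the values at or above it up by one.
insertPoint : Cell → GP → GP
insertPoint c g = insertByCol (rowSlot c g , c) (map (map₁ (bump (rowSlot c g))) g)

module _ (c : Cell) (g : GP) where

  private
    w : ℕ
    w = rowSlot c g

  length-insertPoint : length (insertPoint c g) ≡ suc (length g)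
  length-insertPoint = trans (length-insertByCol _ (map (map₁ (bump w)) g)) (cong suc (length-map _ g))

  ∈-insertPoint-new : (w , c) ∈ insertPoint c g
  ∈-insertPoint-new = ∈-insertByCol-self _ (map (map₁ (bump w)) g)

  ∈-insertPoint⁻ : ∀ {e} → e ∈ insertPoint c g → e ≡ (w , c) ⊎ ∃ λ e₀ → e₀ ∈ g × e ≡ map₁ (bump w) e₀
  ∈-insertPoint⁻ e∈ with ∈-insertByCol⁻ _ (map (map₁ (bump w)) g) e∈
  ... | inj₁ e≡new = inj₁ e≡new
  ... | inj₂ e∈old = inj₂ (∈-map⁻ (map₁ (bump w)) e∈old)

  insertPoint-rowsCompatible : AllPairs (λ a b → val a ≢ val b) g → RowsCompatible g →
                               RowsCompatible (insertPoint c g)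
  insertPoint-rowsCompatible distinct-vals compat a∈ b∈ va<vb with ∈-insertPoint⁻ a∈ | ∈-insertPoint⁻ b∈
  ... | inj₁ refl | inj₁ refl = ⊥-elim (ℕ.<-irrefl refl va<vb)
  ... | inj₂ (a₀ , a₀∈ , refl) | inj₂ (b₀ , b₀∈ , refl) = compat a₀∈ b₀∈ (Bump.cancel-< w va<vb)
  ... | inj₁ refl | inj₂ (b₀ , b₀∈ , refl) = ℕ.≮⇒≥ λ b₀-below →
    ℕ.<-asym va<vb (from (bump<⇔< w (val b₀)) (val<rowSlot c g b₀∈ b₀-below))
  ... | inj₂ (a₀ , a₀∈ , refl) | inj₁ refl
    with <rowSlot⇒ c g (to (bump<⇔< w (val a₀)) va<vb)
  ...   | e , e∈ , e-below , va₀≤ve with ℕ.m≤n⇒m<n∨m≡n va₀≤ve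
  ...     | inj₁ va₀<ve = ℕ.<⇒≤ (ℕ.≤-<-trans (compat a₀∈ e∈ va₀<ve) e-below)
  ...     | inj₂ va₀≡ve = ℕ.<⇒≤ (subst (λ a → row a < proj₂ c) a₀≡e e-below)
    where a₀≡e = sym (AllPairs-≢-injective distinct-vals a₀∈ e∈ va₀≡ve)

  insertPoint-gridded : ∀ {t u} → proj₁ c < t → proj₂ c < u →
                        IsGridded t u g → IsGridded t u (insertPoint c g)
  insertPoint-gridded c-col c-row G = record
    { vals-bounded    = subst (λ n → All (λ e → val e < n) (insertPoint c g)) (sym length-insertPoint)
        (All-insertByCol _ (s≤s (rowSlot≤ c g vals-bounded))
          (All.map⁺ (All.map (λ v<n → ℕ.≤-<-trans (bump≤suc w _) (s≤s v<n)) vals-bounded)))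
    ; vals-distinct   = AllPairs-insertByCol _ (λ a≢b → a≢b ∘ sym)
        (All.map⁺ (All.tabulate (λ _ → bump≢ w _ ∘ sym)))
        (AllPairs.map⁺ (AllPairs.map (λ va≢vb → va≢vb ∘ Bump.injective w) vals-distinct))
    ; cells-bounded   = All-insertByCol _ (c-col , c-row) (All.map⁺ cells-bounded)
    ; cols-sorted     = insertByCol-sorted _ (AllPairs.map⁺ cols-sorted)
    ; rows-compatible = insertPoint-rowsCompatible vals-distinct rows-compatible
    }
    where open IsGridded G

  contains-insertPoint⁺ : ∀ {h} → T (contains g h) → T (contains (insertPoint c g) h)
  contains-insertPoint⁺ {h} g∋h = contains-mono (⊆-insertByCol _ (map (map₁ (bump w)) g))
    (subst T (sym (contains-relabel (bump w) (Bump.<ᵇ-invariant w) g h)) g∋h)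

  contains-insertPoint⁻ : ∀ {h} → T (contains (insertPoint c g) h) →
    T (contains g h) ⊎ map cell h ≡ [ c ] ⊎
    (c ∈ map cell h × ∃ λ e → e ∈ g × cell e ∈ map cell h)
  contains-insertPoint⁻ {h} g′∋h with contains⁻ g′∋h
  ... | s , s⊆ , s≈h with ⊆-insertByCol⁻ _ (map (map₁ (bump w)) g) s⊆
  ...   | inj₁ s⊆old =
    inj₁ (subst T (contains-relabel (bump w) (Bump.<ᵇ-invariant w) g h) (contains⁺ s⊆old s≈h))
  ...   | inj₂ (inj₁ refl) = inj₂ (inj₁ (sym cells≡))
    where cells≡ = cellsEq⇒≡ _ _ (proj₂ (to T-∧ s≈h))
  ...   | inj₂ (inj₂ (new∈s , y , y∈s , y∈old)) with ∈-map⁻ (map₁ (bump w)) y∈old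
  ...     | y₀ , y₀∈ , refl = inj₂ (inj₂ (cell∈ new∈s , y₀ , y₀∈ , cell∈ y∈s))
    where
    cell∈ : ∀ {e} → e ∈ s → cell e ∈ map cell h
    cell∈ e∈s = subst (_ ∈_) (cellsEq⇒≡ _ _ (proj₂ (to T-∧ s≈h))) (∈-map⁺ cell e∈s)

-- Counting

module _ {A : Set} {p q : A → Bool} (p⇒q : ∀ {x} → T (p x) → T (q x)) where

  filterᵇ-⊆ : ∀ xs → filterᵇ p xs ⊆ filterᵇ q xs
  filterᵇ-⊆ xs = filter⁺ (T? ∘ p) (T? ∘ q) {as = xs} (λ { refl → p⇒q }) ⊆-refl

  length-filterᵇ-mono : ∀ xs → length (filterᵇ p xs) ≤ length (filterᵇ q xs)
  length-filterᵇ-mono xs = length-mono-≤ (filterᵇ-⊆ xs)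

  length-filterᵇ-mono-< : ∀ {xs x} → x ∈ xs → ¬ T (p x) → T (q x) →
                          length (filterᵇ p xs) < length (filterᵇ q xs)
  length-filterᵇ-mono-< {xs} {x} x∈ ¬px qx = ℕ.≤∧≢⇒< (length-filterᵇ-mono xs) λ len≡ →
    let filters≡ = ≋⇒≡ (to-≋ len≡ (filterᵇ-⊆ xs))
    in ¬px (proj₂ (∈-filter⁻ (T? ∘ p) {xs = xs}
                               (subst (x ∈_) (sym filters≡) (∈-filter⁺ (T? ∘ q) x∈ qx))))

∈-words : {A : Set} (as l : List A) → All (_∈ as) l → l ∈ words as (length l)
∈-words as []      []            = here refl
∈-words as (a ∷ l) (a∈as ∷ l⊆as) = ∈-concatMap⁺ _ (lose a∈as (∈-map⁺ (a ∷_) (∈-words as l l⊆as)))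

∈-allCells : ∀ {t u x y} → x < t → y < u → (x , y) ∈ allCells t u
∈-allCells x<t y<u = ∈-concatMap⁺ _ (lose (∈-upTo⁺ x<t) (∈-map⁺ _ (∈-upTo⁺ y<u)))

zip-val-cell : ∀ (g : GP) → zip (map val g) (map cell g) ≡ g
zip-val-cell []      = refl
zip-val-cell (e ∷ g) = cong (e ∷_) (zip-val-cell g)

∈-allGP : ∀ {t u} g → T (isGP t u g) → g ∈ allGP t u (length g)
∈-allGP {t} {u} g gp = ∈-filter⁺ (T? ∘ isGP t u)
  (∈-concatMap⁺ _ (lose vals∈ (subst (_∈ map (zip (map val g)) (words (allCells t u) n))
                                     (zip-val-cell g) (∈-map⁺ (zip (map val g)) cells∈)))) gp
  where
  open IsGridded (to (isGP⇔IsGridded t u g) gp)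
  n = length g
  vals∈ : map val g ∈ filterᵇ distinct (words (upTo n) n)
  vals∈ = ∈-filter⁺ (T? ∘ distinct)
    (subst (λ k → map val g ∈ words (upTo n) k) (length-map val g)
      (∈-words (upTo n) (map val g) (All.map⁺ (All.map ∈-upTo⁺ vals-bounded))))
    (from (distinct⇔Unique (map val g)) (AllPairs.map⁺ vals-distinct))
  cells∈ : map cell g ∈ words (allCells t u) n
  cells∈ = subst (λ k → map cell g ∈ words (allCells t u) k) (length-map cell g)
    (∈-words (allCells t u) (map cell g)
      (All.map⁺ (All.map (λ { (x<t , y<u) → ∈-allCells {t} {u} x<t y<u }) cells-bounded)))

module _ {t u : ℕ} {p q : GP → Bool} (p⇒q : ∀ {g} → T (p g) → T (q g)) where

  count-mono : ∀ n → count t u p n ≤ count t u q n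
  count-mono n = length-filterᵇ-mono p⇒q (allGP t u n)

  count-mono-< : ∀ {g} → T (isGP t u g) → ¬ T (p g) → T (q g) →
                 count t u p (length g) < count t u q (length g)
  count-mono-< {g} gp = length-filterᵇ-mono-< p⇒q (∈-allGP {t} {u} g gp)

-- allGP t u 0 computes to [ [] ], so the count at size 0 is decided by p [].
count-zero : ∀ {t u} p → ¬ T (p []) → count t u p 0 ≡ 0
count-zero p ¬p[] with p []
... | false = refl
... | true  = ⊥-elim (¬p[] _)

inGrid⁺ : ∀ 𝒯 g → T (isGP (t 𝒯) (u 𝒯) g) → T (avoidsObs 𝒯 g) → T (all (any (contains g)) (reqs 𝒯)) →
          T (inGrid 𝒯 g)
inGrid⁺ 𝒯 g gp avoids reqs-met =
  from (T-∧ {isGP (t 𝒯) (u 𝒯) g}) (gp , from (T-∧ {avoidsObs 𝒯 g}) (avoids , reqs-met))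

inGrid⇒isGP : ∀ 𝒯 g → T (inGrid 𝒯 g) → T (isGP (t 𝒯) (u 𝒯) g)
inGrid⇒isGP 𝒯 g g∈ = proj₁ (to (T-∧ {isGP (t 𝒯) (u 𝒯) g}) g∈)

inGrid⇒requirements : ∀ 𝒯 g → T (inGrid 𝒯 g) → T (all (any (contains g)) (reqs 𝒯))
inGrid⇒requirements 𝒯 g g∈ =
  proj₂ (to (T-∧ {avoidsObs 𝒯 g}) (proj₂ (to (T-∧ {isGP (t 𝒯) (u 𝒯) g}) g∈)))

module _ (𝒯 : Tiling) {m : ℕ} (P : Fin m → List Cell) (k : Fin m) (g : GP) (g∈ : T (inChild 𝒯 P k g)) where

  private
    inPartᵏ : Entry → Bool
    inPartᵏ e = inPart (P k) (cell e)

    requirementMet : List GP → Bool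
    requirementMet R = not (all (all inPartᵏ) R) ∨ any (contains g) R

    unpack : T (isGP (t 𝒯) (u 𝒯) g) × T (all inPartᵏ g) × T (avoidsObs 𝒯 g) ×
             T (all requirementMet (reqs 𝒯))
    unpack = let gp , rest = to (T-∧ {isGP (t 𝒯) (u 𝒯) g}) g∈
                 cells , rest′ = to (T-∧ {all inPartᵏ g}) rest
                 avoids , reqs-met = to (T-∧ {avoidsObs 𝒯 g}) rest′
             in gp , cells , avoids , reqs-met

  inChild⇒isGP : T (isGP (t 𝒯) (u 𝒯) g)
  inChild⇒isGP = proj₁ unpack

  inChild⇒cells : ∀ {e} → e ∈ g → cell e ∈ P k
  inChild⇒cells e∈ = to inPart⇔∈ (allᵇ-lookup inPartᵏ (proj₁ (proj₂ unpack)) e∈)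

  inChild⇒avoids : T (avoidsObs 𝒯 g)
  inChild⇒avoids = proj₁ (proj₂ (proj₂ unpack))

  inChild⇒requirement : ∀ {R} → R ∈ reqs 𝒯 → (∀ h → h ∈ R → ∀ e → e ∈ h → cell e ∈ P k) →
                        T (any (contains g) R)
  inChild⇒requirement {R} R∈ R⊆Pk
    with to T-∨ (allᵇ-lookup requirementMet (proj₂ (proj₂ (proj₂ unpack))) R∈)
  ... | inj₂ met = met
  ... | inj₁ notInPart = ⊥-elim (to T-not notInPart
        (allᵇ-tabulate (all inPartᵏ) λ {h} h∈ →
          allᵇ-tabulate inPartᵏ λ {e} e∈ → from inPart⇔∈ (R⊆Pk h h∈ e e∈)))

singleCell-obstruction : ∀ 𝒯 → WellFormed 𝒯 → ∀ {o c} → o ∈ obs 𝒯 → map cell o ≡ [ c ] → EmptyCell 𝒯 c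
singleCell-obstruction 𝒯 wf {(v , c) ∷ []} o∈ refl
  with IsGridded.vals-bounded (to (isGP⇔IsGridded (t 𝒯) (u 𝒯) ((v , c) ∷ [])) (from T-≡ (proj₁ wf _ o∈)))
... | s≤s z≤n ∷ [] = o∈

module Factor (𝒯 : Tiling) {m : ℕ} (P : Fin m → List Cell) (ni : NonInteracting 𝒯 m P) (i : Fin m)
              (others∋[] : ∀ k → k ≢ i → T (inChild 𝒯 P k [])) where

  child⊆grid : ∀ {g} → T (inChild 𝒯 P i g) → T (inGrid 𝒯 g)
  child⊆grid {g} g∈ = inGrid⁺ 𝒯 g (inChild⇒isGP 𝒯 P i g g∈) (inChild⇒avoids 𝒯 P i g g∈)
    (allᵇ-tabulate (any (contains g)) requirement)
    where
    requirement : ∀ {R} → R ∈ reqs 𝒯 → T (any (contains g) R)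
    requirement {R} R∈ with proj₂ (proj₂ ni) R R∈
    ... | k , R⊆Pk with k ≟ i
    ...   | yes refl = inChild⇒requirement 𝒯 P i g g∈ R∈ R⊆Pk
    ...   | no k≢i   = any-mono (contains-mono (minimum g)) R
                         (inChild⇒requirement 𝒯 P k [] (others∋[] k k≢i) R∈ R⊆Pk)

  countB≤countA : ∀ n → countB 𝒯 P i n ≤ countA 𝒯 n
  countB≤countA = count-mono {t 𝒯} {u 𝒯} {inChild 𝒯 P i} {inGrid 𝒯} (λ {g} → child⊆grid {g})

  module _ (wf : WellFormed 𝒯) (partition : IsPartition 𝒯 m P) {j : Fin m} (j≢i : j ≢ i)
           {c : Cell} (c∈Pj : c ∈ P j) (g : GP) (g∈ : T (inChild 𝒯 P i g)) where

    private
      c-nonempty : NonemptyCell 𝒯 c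
      c-nonempty = proj₁ partition j c c∈Pj

    insertPoint∉child : ¬ T (inChild 𝒯 P i (insertPoint c g))
    insertPoint∉child g′∈ =
      j≢i (proj₂ (proj₂ partition) j i c c∈Pj
             (inChild⇒cells 𝒯 P i (insertPoint c g) g′∈ (∈-insertPoint-new c g)))

    insertPoint-avoids : T (avoidsObs 𝒯 (insertPoint c g))
    insertPoint-avoids =
      allᵇ-tabulate (λ o → not (contains (insertPoint c g) o)) (λ o∈ → from T-not (avoids o∈))
      where
      avoids : ∀ {o} → o ∈ obs 𝒯 → ¬ T (contains (insertPoint c g) o)
      avoids {o} o∈ g′∋o with contains-insertPoint⁻ c g g′∋o
      ... | inj₁ g∋o =
        to T-not (allᵇ-lookup (λ o → not (contains g o)) (inChild⇒avoids 𝒯 P i g g∈) o∈) g∋o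
      ... | inj₂ (inj₁ cells≡[c]) = proj₂ c-nonempty (singleCell-obstruction 𝒯 wf o∈ cells≡[c])
      ... | inj₂ (inj₂ (c∈o , e , e∈g , ce∈o)) with ∈-map⁻ cell c∈o | ∈-map⁻ cell ce∈o
      ...   | e₁ , e₁∈o , refl | e₂ , e₂∈o , ce≡ =
        proj₁ (proj₂ ni) o o∈ j i e₁ e₂ j≢i e₁∈o e₂∈o c∈Pj
          (subst (_∈ P i) ce≡ (inChild⇒cells 𝒯 P i g g∈ e∈g))

    insertPoint∈grid : T (inGrid 𝒯 (insertPoint c g))
    insertPoint∈grid = inGrid⁺ 𝒯 (insertPoint c g)
      (from (isGP⇔IsGridded (t 𝒯) (u 𝒯) (insertPoint c g))
            (insertPoint-gridded c g c-col c-row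
              (to (isGP⇔IsGridded (t 𝒯) (u 𝒯) g) (inChild⇒isGP 𝒯 P i g g∈))))
      insertPoint-avoids
      (all-any-mono (contains-insertPoint⁺ c g) (reqs 𝒯) (inGrid⇒requirements 𝒯 g (child⊆grid {g} g∈)))
      where
      c-col = proj₁ (proj₁ c-nonempty)
      c-row = proj₂ (proj₁ c-nonempty)

    countB<countA : countB 𝒯 P i (length (insertPoint c g)) < countA 𝒯 (length (insertPoint c g))
    countB<countA = count-mono-< {t 𝒯} {u 𝒯} {inChild 𝒯 P i} {inGrid 𝒯} (λ {g} → child⊆grid {g})
      {insertPoint c g} (inGrid⇒isGP 𝒯 (insertPoint c g) insertPoint∈grid)
      insertPoint∉child insertPoint∈grid

module _ (𝒯 : Tiling) {m : ℕ} (P : Fin m → List Cell) (i : Fin m) where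

  reliance≤ : ∀ n → reliance 𝒯 P i n ≤ℤ + n
  reliance≤ n with inS 𝒯 P i
  ... | true  = ℤ.i-j≤i (+ n) (+ 1)
  ... | false = ℤ.≤-refl

  -- + N - + 1 is definitionally ℤ.pred (+ N).
  full-reliance⇒∉S : ∀ N → + N ≤ℤ reliance 𝒯 P i N → inS 𝒯 P i ≡ false
  full-reliance⇒∉S N N≤r with inS 𝒯 P i
  ... | true  = ⊥-elim (ℤ.<-irrefl refl (ℤ.i≤pred[j]⇒i<j N≤r))
  ... | false = refl

  ∉S⇒others∋[] : inS 𝒯 P i ≡ false → ∀ k → k ≢ i → T (inChild 𝒯 P k [])
  ∉S⇒others∋[] ∉S k k≢i with T? (inChild 𝒯 P k [])
  ... | yes k∋[] = k∋[]
  ... | no  k∌[] = ⊥-elim (subst T ∉S (anyᵇ-lose _ (∈-allFin k) witness))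
    where
    witness : T (not (does (k ≟ i)) ∧ (countB 𝒯 P k 0 ≡ᵇ 0))
    witness rewrite count-zero {t 𝒯} {u 𝒯} (inChild 𝒯 P k) k∌[] with k ≟ i
    ... | yes k≡i = k≢i k≡i
    ... | no  _   = _

occupiedCell : ∀ 𝒯 {m} (P : Fin m → List Cell) k →
               ∃[ g ] ((inChild 𝒯 P k g ≡ true) × (1 ≤ length g)) → ∃ λ c → c ∈ P k
occupiedCell 𝒯 P k (e ∷ g , g∈ , _) = cell e , inChild⇒cells 𝒯 P k (e ∷ g) (from T-≡ g∈) (here refl)

another : ∀ {m} → 2 ≤ m → (i : Fin m) → ∃ λ j → j ≢ i
another (s≤s (s≤s _)) fzero    = fsuc fzero , λ ()
another (s≤s (s≤s _)) (fsuc _) = fzero , λ ()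

theorem6p15 : (T : Tiling) → WellFormed T →
    (m : ℕ) → 2 ≤ m → (P : Fin m → List Cell) →
    IsPartition T m P → NonInteracting T m P →
    (∀ i → ∃[ g ] ((inChild T P i g ≡ true) × (1 ≤ length g))) →
    (∀ i n → reliance T P i n ≤ℤ + n) ×
    (∀ i → (∃[ N ] (+ N ≤ℤ reliance T P i N)) →
      (∀ n → countB T P i n ≤ countA T n) × (∃[ ℓ ] (countB T P i ℓ < countA T ℓ)))
theorem6p15 𝒯 wf m 2≤m P partition ni children = reliance≤ 𝒯 P , productive
  where
  productive : ∀ i → ∃[ N ] (+ N ≤ℤ reliance 𝒯 P i N) →
               (∀ n → countB 𝒯 P i n ≤ countA 𝒯 n) × ∃[ ℓ ] (countB 𝒯 P i ℓ < countA 𝒯 ℓ)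
  productive i (N , full) =
    let open Factor 𝒯 P ni i (∉S⇒others∋[] 𝒯 P i (full-reliance⇒∉S 𝒯 P i N full))
        j , j≢i    = another 2≤m i
        g , g∈ , _ = children i
        c , c∈Pj   = occupiedCell 𝒯 P j (children j)
    in countB≤countA , length (insertPoint c g) , countB<countA wf partition j≢i c∈Pj g (from T-≡ g∈)
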